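{- For all transitive sets $X$ and $Y$ such that $Y \subset X$, the function $h : \mathcal{P}(X^{<\omega}) \to \mathcal{P}(Y^{<\omega})$ defined by $h(A) = A \cap Y^{<\omega}$ is a homomorphism from $\mathscr{P}_X$ to $\mathscr{P}_Y$.
   Context: Work in GB + AC. For a set $X$, $X^{<\omega}$ is the set of finite sequences of elements of $X$ and $X^k$ the set of $k$-length sequences. For $j,k<\omega$ and $1\le i_1,\dots,i_j\le k$, $\mathrm{Proj}_{k,\langle i_1,\dots,i_j\rangle}: X^k\to X^j$ sends $\langle x_1,\dots,x_k\rangle$ to $\langle x_{i_1},\dots,x_{i_j}\rangle$. For a transitive set $X$, the $\mathscr{P}$-structure $\mathscr{P}_X$ is the structure with universe $\mathcal{P}(X^{<\omega})$ equipped with: the binary operation $\cap$; the unary operation of complementation $-$ (relative to $X^{<\omega}$); constants $X^k$ for each $k<\omega$; the unary relation $\mathrm{WF}$ consisting of all $A\subset X^{<\omega}$ that are wellfounded under $\supsetneq$ (the reverse of the proper initial segment relation); for each $j,k,i_1,\dots,i_j$ the partial unary operation $\mathrm{Proj}^{ -1}_{k,\langle i_1,\dots,i_j\rangle}:\mathcal{P}(X^j)\to\mathcal{P}(X^k)$, $A\mapsto\{\langle x_1,\dots,x_k\rangle\in X^k : \langle x_{i_1},\dots,x_{i_j}\rangle\in A\}$; and for each $k$ the partial unary operation (bounded projection) $\mathrm{BP}_k:\mathcal{P}(X^{k+1})\to\mathcal{P}(X^{k+1})$, $\mathrm{BP}_k(A)=\{\langle x_1,\dots,x_{k+1}\rangle\in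 X^{k+1} : \exists z\in x_{k+1}\ \langle x_1,\dots,x_k,z\rangle\in A\}$. A homomorphism of $\mathscr{P}$-structures is a function preserving (commuting with) all the operations, partial operations and constants, and preserving the relation $\mathrm{WF}$ (but not necessarily its failure). -}

module Defs where

open import Level using (0ℓ)
open import Data.Nat using (ℕ; suc)
open import Data.Fin using (Fin; cast)
open import Data.List using (List; []; _∷_; _++_; _∷ʳ_; length; lookup)
import Data.List as List
open import Data.List.Relation.Unary.All using (All)
open import Data.Vec using (Vec; toList)
open import Data.Product using (Σ; _×_; _,_)
open import Relation.Binary.PropositionalEquality using (_≡_; _≢_; sym)
open import Relation.Unary using (Pred; _∩_; _⊆_; _≐_; ∁)
open import Induction.WellFounded using (Acc)

-- A universe of sets: a type U with an arbitrary membership relation _∈_.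
module PStructure (U : Set) (_∈_ : U → U → Set) where

  Transitive : U → Set
  Transitive X = ∀ {y z} → y ∈ X → z ∈ y → z ∈ X

  -- X^{<ω}: finite sequences (lists) of elements of X
  Seq : U → Pred (List U) 0ℓ
  Seq X s = All (_∈ X) s

  Pow : U → ℕ → Pred (List U) 0ℓ
  Pow X k s = All (_∈ X) s × length s ≡ k

  Comp : U → Pred (List U) 0ℓ → Pred (List U) 0ℓ
  Comp X A = Seq X ∩ ∁ A

  ProperPrefix : List U → List U → Set
  ProperPrefix u t = Σ (List U) λ xs → xs ≢ [] × (u ++ xs ≡ t)

  -- the relation ⊋ restricted to A: t R u iff t ∈ A and t properly extends u
  Ext : Pred (List U) 0ℓ → List U → List U → Set
  Ext A t u = A t × ProperPrefix u t

  WF : Pred (List U) 0ℓ → Set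
  WF A = ∀ s → A s → Acc (Ext A) s

  -- Proj_{k,is}(s), given that s has length k (indices 0-based)
  proj : (k : ℕ) {j : ℕ} → Vec (Fin k) j → (s : List U) → length s ≡ k → List U
  proj k is s p = List.map (λ i → lookup s (cast (sym p) i)) (toList is)

  PreImg : U → (k : ℕ) {j : ℕ} → Vec (Fin k) j → Pred (List U) 0ℓ → Pred (List U) 0ℓ
  PreImg X k is A s = Σ (All (_∈ X) s) λ _ → Σ (length s ≡ k) λ p → A (proj k is s p)

  BP : U → ℕ → Pred (List U) 0ℓ → Pred (List U) 0ℓ
  BP X k A s = Pow X (suc k) s ×
    Σ (List U) λ xs → Σ U λ x → (s ≡ xs ∷ʳ x) × Σ U λ z → z ∈ x × A (xs ∷ʳ z)

  record IsHom (X Y : U) (h : Pred (List U) 0ℓ → Pred (List U) 0ℓ) : Set₁ where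
    field
      resp   : ∀ A B → A ⊆ Seq X → B ⊆ Seq X → A ≐ B → h A ≐ h B
      into   : ∀ A → A ⊆ Seq X → h A ⊆ Seq Y
      hom-∩  : ∀ A B → A ⊆ Seq X → B ⊆ Seq X → h (A ∩ B) ≐ (h A ∩ h B)
      hom-∁  : ∀ A → A ⊆ Seq X → h (Comp X A) ≐ Comp Y (h A)
      hom-Pow : ∀ k → h (Pow X k) ≐ Pow Y k
      hom-WF : ∀ A → A ⊆ Seq X → WF A → WF (h A)
      hom-Proj : ∀ j k (is : Vec (Fin k) j) A → A ⊆ Pow X j →
                 h (PreImg X k is A) ≐ PreImg Y k is (h A)
      hom-BP : ∀ k A → A ⊆ Pow X (suc k) → h (BP X k A) ≐ BP Y k (h A)

module Submission where

-- Write A ↾ Y for A ∩ Y^{<ω}.  Each operation of a P-structure is built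
-- from membership conditions on the entries of a sequence, so it commutes
-- with ↾ Y as soon as the relevant sequences stay inside Y^{<ω}:
--   * ∩, complement and the constants X^k only need Y ⊆ X;
--   * Proj^{-1} needs that a projection of a Y-sequence is a Y-sequence;
--   * BP needs that replacing the last entry x of a Y-sequence by some
--     z ∈ x gives a Y-sequence again, i.e. that Y is transitive;
--   * WF is preserved because the ⊋-relation on a subset of A is a
--     subrelation of that on A, so accessibility is inherited.

open import Defs
open import Level using (0ℓ)
open import Data.Fin using (Fin)
open import Data.List using (List; _∷ʳ_)
open import Data.List.Relation.Unary.All as All using (All)
open import Data.List.Relation.Unary.All.Properties using (map⁺; ∷ʳ⁺; ∷ʳ⁻)
open import Data.List.Membership.Propositional.Properties using (∈-lookup)
open import Data.Vec using (Vec)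
open import Data.Product using (_,_; proj₂)
open import Relation.Binary.PropositionalEquality using (refl)
open import Relation.Unary using (Pred; _∩_; _⊆_; _≐_)
open import Induction.WellFounded using (Acc; acc)

module Restriction (U : Set) (_∈_ : U → U → Set) where
  open PStructure U _∈_

  _↾_ : Pred (List U) 0ℓ → U → Pred (List U) 0ℓ
  A ↾ Y = A ∩ Seq Y

  Seq-mono : ∀ {X Y} → (∀ {z} → z ∈ Y → z ∈ X) → Seq Y ⊆ Seq X
  Seq-mono Y⊆X = All.map Y⊆X

  -- Every entry of a projection of s is an entry of s.
  Seq-proj : ∀ {Y} k {j} (is : Vec (Fin k) j) s p → Seq Y s → Seq Y (proj k is s p)
  Seq-proj k is s p s∈Y = map⁺ (All.tabulate λ _ → All.lookup s∈Y (∈-lookup _))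

  Seq-lower-last : ∀ {Y xs x z} → Transitive Y →
                   Seq Y (xs ∷ʳ x) → z ∈ x → Seq Y (xs ∷ʳ z)
  Seq-lower-last tY xsx∈Y z∈x =
    let (xs∈Y , x∈Y) = ∷ʳ⁻ xsx∈Y in ∷ʳ⁺ xs∈Y (tY x∈Y z∈x)

  Acc-∩ : ∀ (A B : Pred (List U) 0ℓ) s → Acc (Ext A) s → Acc (Ext (A ∩ B)) s
  Acc-∩ A B s (acc rs) = acc λ { ((a , _) , t⊋s) → Acc-∩ A B _ (rs (a , t⊋s)) }

  WF-∩ : ∀ (A B : Pred (List U) 0ℓ) → WF A → WF (A ∩ B)
  WF-∩ A B wf s (a , _) = Acc-∩ A B s (wf s a)

  ↾-resp : ∀ {A B} Y → A ≐ B → (A ↾ Y) ≐ (B ↾ Y)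
  ↾-resp Y (A⊆B , B⊆A) = (λ (a , y) → A⊆B a , y) , (λ (b , y) → B⊆A b , y)

  ↾-∩ : ∀ A B Y → ((A ∩ B) ↾ Y) ≐ ((A ↾ Y) ∩ (B ↾ Y))
  ↾-∩ A B Y = (λ ((a , b) , y) → (a , y) , (b , y))
            , (λ ((a , y) , (b , _)) → (a , b) , y)

  module _ {X Y : U} (Y⊆X : ∀ {z} → z ∈ Y → z ∈ X) where

    ↾-Comp : ∀ A → (Comp X A ↾ Y) ≐ Comp Y (A ↾ Y)
    ↾-Comp A = (λ ((_ , a∉) , y) → y , λ (a , _) → a∉ a)
             , (λ (y , a↾∉) → (Seq-mono Y⊆X y , λ a → a↾∉ (a , y)) , y)

    ↾-Pow : ∀ k → (Pow X k ↾ Y) ≐ Pow Y k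
    ↾-Pow k = (λ ((_ , len) , y) → y , len)
            , (λ (y , len) → (Seq-mono Y⊆X y , len) , y)

    ↾-PreImg : ∀ k {j} (is : Vec (Fin k) j) A →
               (PreImg X k is A ↾ Y) ≐ PreImg Y k is (A ↾ Y)
    ↾-PreImg k is A =
        (λ { {s} ((_ , p , a) , y) → y , p , a , Seq-proj k is s p y })
      , (λ (y , p , a , _) → (Seq-mono Y⊆X y , p , a) , y)

    ↾-BP : Transitive Y → ∀ k A → (BP X k A ↾ Y) ≐ BP Y k (A ↾ Y)
    ↾-BP tY k A =
        (λ { (((_ , len) , xs , x , refl , z , z∈x , a) , y) →
               (y , len) , xs , x , refl , z , z∈x , a , Seq-lower-last tY y z∈x })
      , (λ ((y , len) , xs , x , s≡ , z , z∈x , a , _) →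
               ((Seq-mono Y⊆X y , len) , xs , x , s≡ , z , z∈x , a) , y)

lemma2p3 : (U : Set) (_∈_ : U → U → Set) (X Y : U) →
    PStructure.Transitive U _∈_ X → PStructure.Transitive U _∈_ Y →
    (∀ {z} → z ∈ Y → z ∈ X) →
    PStructure.IsHom U _∈_ X Y (λ A → A ∩ PStructure.Seq U _∈_ Y)
lemma2p3 U _∈_ X Y _ tY Y⊆X = record
  { resp     = λ A B _ _ → ↾-resp Y
  ; into     = λ A _ → proj₂
  ; hom-∩    = λ A B _ _ → ↾-∩ A B Y
  ; hom-∁    = λ A _ → ↾-Comp Y⊆X A
  ; hom-Pow  = ↾-Pow Y⊆X
  ; hom-WF   = λ A _ → WF-∩ A (Seq Y)
  ; hom-Proj = λ j k is A _ → ↾-PreImg Y⊆X k is A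
  ; hom-BP   = λ k A _ → ↾-BP Y⊆X tY k A
  }
  where
    open PStructure U _∈_
    open Restriction U _∈_
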